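{- Let $G$ be a directed graph and $v,w$ vertices of $G$ such that $G$ contains a bi-directional arrow between $v$ and $w$ and the out-degree of $v$ is $1$. Let $G'$ be the directed graph with $V(G')=V(G)$ obtained from $G$ by replacing this bi-directional arrow by a one-directional arrow from $v$ to $w$. Then $L_G$ and $L_{G'}$ are row equivalent over $\mathbb{Z}$ (i.e., $L_{G'}=PL_G$ for some $P\in GL_n(\mathbb{Z})$); in particular $\operatorname{Pic}(G)\cong\operatorname{Pic}(G')$ and $\operatorname{Jac}(G)\cong\operatorname{Jac}(G')$.
   Context: A directed graph has finitely many vertices $v_1,\dots,v_n$ and finitely many arrows (no loops), each one-directional or bi-directional; a bi-directional arrow between $u,w$ counts as an arrow from $u$ to $w$ and one from $w$ to $u$. The out-degree of a vertex is its number of outgoing arrows. The Laplacian $L_G$ is the $n\times n$ integer matrix with $(i,i)$ entry the out-degree of $v_i$ and $(i,j)$ entry ($i\ne j$) minus the number of arrows from $v_i$ to $v_j$. $\operatorname{Pic}(G)=\mathbb{Z}^n/L_G^T\mathbb{Z}^n$ and $\operatorname{Jac}(G)$ is its torsion subgroup. -}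

module Defs where

open import Data.Nat using (ℕ; zero; suc; _+_)
open import Data.Integer as ℤ using (ℤ; +_; -_)
open import Data.Fin using (Fin; zero; suc; _≟_)
open import Data.Bool using (Bool; true; false)
open import Data.List using (List; []; _∷_; length; lookup; updateAt)
open import Relation.Nullary using (¬_; yes; no)
open import Data.Product using (Σ; _×_)
open import Data.Sum using (_⊎_)
open import Relation.Binary.PropositionalEquality using (_≡_)

record Arrow (n : ℕ) : Set where
  constructor arrow
  field
    src    : Fin n
    tgt    : Fin n
    bidir  : Bool
    noLoop : ¬ (src ≡ tgt)
open Arrow public

-- A directed graph on vertices v_1..v_n (= Fin n): a finite list of arrows
-- (multiple arrows allowed).
DiGraph : ℕ → Set
DiGraph n = List (Arrow n)

match : ∀ {n} → Fin n → Fin n → Fin n → Fin n → ℕ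
match a b i j with a ≟ i | b ≟ j
... | yes _ | yes _ = 1
... | _     | _     = 0

-- number of arrows from i to j contributed by one arrow
-- (a bi-directional arrow u–w counts as an arrow u→w and an arrow w→u)
arrowCount : ∀ {n} → Arrow n → Fin n → Fin n → ℕ
arrowCount (arrow s t false _) i j = match s t i j
arrowCount (arrow s t true  _) i j = match s t i j + match t s i j

numArrows : ∀ {n} → DiGraph n → Fin n → Fin n → ℕ
numArrows []      i j = 0
numArrows (e ∷ G) i j = arrowCount e i j + numArrows G i j

sumFin : ∀ {A : Set} → (A → A → A) → A → (n : ℕ) → (Fin n → A) → A
sumFin _+'_ z zero    f = z
sumFin _+'_ z (suc n) f = f zero +' sumFin _+'_ z n (λ i → f (suc i))

outDeg : ∀ {n} → DiGraph n → Fin n → ℕ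
outDeg {n} G i = sumFin _+_ 0 n (λ j → numArrows G i j)

Matrix : ℕ → Set
Matrix n = Fin n → Fin n → ℤ

_*M_ : ∀ {n} → Matrix n → Matrix n → Matrix n
_*M_ {n} A B i j = sumFin ℤ._+_ (+ 0) n (λ k → A i k ℤ.* B k j)

identityM : ∀ {n} → Matrix n
identityM i j with i ≟ j
... | yes _ = + 1
... | no  _ = + 0

_≡M_ : ∀ {n} → Matrix n → Matrix n → Set
A ≡M B = ∀ i j → A i j ≡ B i j

record InGL {n : ℕ} (P : Matrix n) : Set where
  field
    inv    : Matrix n
    invˡ   : (inv *M P) ≡M identityM
    invʳ   : (P *M inv) ≡M identityM

laplacian : ∀ {n} → DiGraph n → Matrix n
laplacian G i j with i ≟ j
... | yes _ = + outDeg G i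
... | no  _ = - (+ numArrows G i j)

IsBidirBetween : ∀ {n} → (G : DiGraph n) → Fin (length G) → Fin n → Fin n → Set
IsBidirBetween G k v w =
  bidir (lookup G k) ≡ true × 
  ((src (lookup G k) ≡ v × tgt (lookup G k) ≡ w) ⊎ (src (lookup G k) ≡ w × tgt (lookup G k) ≡ v))

replaceOneDir : ∀ {n} → (G : DiGraph n) → Fin (length G) → (v w : Fin n) → ¬ (v ≡ w) → DiGraph n
replaceOneDir G k v w v≢w = updateAt G k (λ _ → arrow v w false v≢w)

RowEquiv : ∀ {n} → Matrix n → Matrix n → Set
RowEquiv L L' = Σ (Matrix _) (λ P → InGL P × (L' ≡M (P *M L)))

-- The Laplacian is additive in the arrows. Writing G = H + (v ↔ w) and G' = H + (v → w), we get
-- L_G − L_G' = L_{w→v} = e_w (e_w − e_v)ᵀ. Since v has out-degree 1, H has no arrows out of v, so row v of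
-- L_G is e_v − e_w; hence L_G' = L_G + e_w · (row v of L_G), i.e. L_G' is obtained from L_G by the
-- elementary row operation "add row v to row w", which is invertible over ℤ.
module Submission where

open import Defs
open import Algebra.Bundles using (Monoid)
open import Level using (0ℓ)
import Algebra.Properties.CommutativeMonoid.Sum as CommutativeMonoidSum
open import Data.Bool using (true)
open import Data.Fin using (Fin; zero; suc; _≟_)
open import Data.Fin.Properties using (suc-injective)
open import Data.Integer as ℤ using (ℤ; +_; -_)
import Data.Integer.Properties as ℤP
open import Data.Integer.Tactic.RingSolver using (solve-∀)
open import Data.List using (_∷_; length; lookup; updateAt; removeAt)
open import Data.Nat using (ℕ; zero; suc; _+_)
import Data.Nat.Properties as ℕP
open import Algebra.Properties.CommutativeSemigroup ℕP.+-commutativeSemigroup using (x∙yz≈y∙xz)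
open import Data.Product using (_,_; _×_; proj₁; proj₂)
open import Data.Sum using (_⊎_; inj₁; inj₂)
open import Data.Vec.Functional using (Vector)
open import Function using (_∘_)
open import Relation.Binary.PropositionalEquality using (_≡_; refl; sym; trans; cong; cong₂; module ≡-Reasoning)
open import Relation.Nullary using (¬_; Dec; yes; no; contradiction)

module ℕΣ = CommutativeMonoidSum ℕP.+-0-commutativeMonoid
module ℤΣ = CommutativeMonoidSum ℤP.+-0-commutativeMonoid

module _ {ℓ} (M : Monoid 0ℓ ℓ) where
  open Monoid M using (Carrier; _≈_; _∙_; ε; ∙-cong; ∙-congˡ; identityˡ; identityʳ; setoid)
  open import Algebra.Properties.Monoid.Sum M using (sum; sum-cong-≋; sum-replicate-zero)
  open import Relation.Binary.Reasoning.Setoid setoid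

  sumFin≡sum : ∀ n (f : Fin n → Carrier) → sumFin _∙_ ε n f ≡ sum f
  sumFin≡sum zero    f = refl
  sumFin≡sum (suc n) f = cong (f zero ∙_) (sumFin≡sum n (f ∘ suc))

  sum-eq-single : ∀ {n} (f : Vector Carrier n) b → (∀ k → ¬ k ≡ b → f k ≈ ε) → sum f ≈ f b
  sum-eq-single {suc n} f zero vanish = begin
    f zero ∙ sum (f ∘ suc)           ≈⟨ ∙-congˡ (sum-cong-≋ (λ k → vanish (suc k) λ ())) ⟩
    f zero ∙ sum (λ (_ : Fin n) → ε) ≈⟨ ∙-congˡ (sum-replicate-zero n) ⟩
    f zero ∙ ε                       ≈⟨ identityʳ (f zero) ⟩
    f zero                           ∎
  sum-eq-single {suc n} f (suc b) vanish = begin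
    f zero ∙ sum (f ∘ suc) ≈⟨ ∙-cong (vanish zero λ ()) (sum-eq-single (f ∘ suc) b (λ k k≢b → vanish (suc k) (k≢b ∘ suc-injective))) ⟩
    ε ∙ f (suc b)          ≈⟨ identityˡ (f (suc b)) ⟩
    f (suc b)              ∎

sum≡0⇒≡0 : ∀ {n} (f : Vector ℕ n) → ℕΣ.sum f ≡ 0 → ∀ k → f k ≡ 0
sum≡0⇒≡0 f sum≡0 zero    = ℕP.m+n≡0⇒m≡0 (f zero) sum≡0
sum≡0⇒≡0 f sum≡0 (suc k) = sum≡0⇒≡0 (f ∘ suc) (ℕP.m+n≡0⇒n≡0 (f zero) sum≡0) k

identityM-refl : ∀ {n} (i : Fin n) → identityM i i ≡ + 1
identityM-refl i with i ≟ i
... | yes _   = refl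
... | no  i≢i = contradiction refl i≢i

identityM-≢ : ∀ {n} {i j : Fin n} → ¬ i ≡ j → identityM i j ≡ + 0
identityM-≢ {i = i} {j} i≢j with i ≟ j
... | yes i≡j = contradiction i≡j i≢j
... | no  _   = refl

*M-as-sum : ∀ {n} (A B : Matrix n) i j → (A *M B) i j ≡ ℤΣ.sum (λ k → A i k ℤ.* B k j)
*M-as-sum {n} A B i j = sumFin≡sum ℤP.+-0-monoid n _

sum-identityM-* : ∀ {n} (i : Fin n) (f : Vector ℤ n) → ℤΣ.sum (λ k → identityM i k ℤ.* f k) ≡ f i
sum-identityM-* i f = begin
  ℤΣ.sum (λ k → identityM i k ℤ.* f k) ≡⟨ sum-eq-single ℤP.+-0-monoid _ i (λ k k≢i → cong (ℤ._* f k) (identityM-≢ (k≢i ∘ sym))) ⟩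
  identityM i i ℤ.* f i              ≡⟨ cong (ℤ._* f i) (identityM-refl i) ⟩
  + 1 ℤ.* f i                        ≡⟨ ℤP.*-identityˡ (f i) ⟩
  f i                                ∎
  where open ≡-Reasoning

transvection : ∀ {n} → Fin n → Fin n → ℤ → Matrix n
transvection a b c i j = identityM i j ℤ.+ c ℤ.* (identityM a i ℤ.* identityM b j)

transvection-*M : ∀ {n} (a b : Fin n) c (B : Matrix n) i j →
                  (transvection a b c *M B) i j ≡ B i j ℤ.+ c ℤ.* (identityM a i ℤ.* B b j)
transvection-*M a b c B i j = begin
  (transvection a b c *M B) i j
    ≡⟨ *M-as-sum (transvection a b c) B i j ⟩
  ℤΣ.sum (λ k → (identityM i k ℤ.+ c ℤ.* (identityM a i ℤ.* identityM b k)) ℤ.* B k j)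
    ≡⟨ ℤΣ.sum-cong-≗ (λ k → regroup c (identityM i k) (identityM a i) (identityM b k) (B k j)) ⟩
  ℤΣ.sum (λ k → identityM i k ℤ.* B k j ℤ.+ identityM b k ℤ.* (c ℤ.* (identityM a i ℤ.* B k j)))
    ≡⟨ ℤΣ.∑-distrib-+ (λ k → identityM i k ℤ.* B k j) _ ⟩
  ℤΣ.sum (λ k → identityM i k ℤ.* B k j) ℤ.+ ℤΣ.sum (λ k → identityM b k ℤ.* (c ℤ.* (identityM a i ℤ.* B k j)))
    ≡⟨ cong₂ ℤ._+_ (sum-identityM-* i (λ k → B k j)) (sum-identityM-* b (λ k → c ℤ.* (identityM a i ℤ.* B k j))) ⟩
  B i j ℤ.+ c ℤ.* (identityM a i ℤ.* B b j) ∎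
  where
  open ≡-Reasoning
  regroup : ∀ c x y z t → (x ℤ.+ c ℤ.* (y ℤ.* z)) ℤ.* t ≡ x ℤ.* t ℤ.+ z ℤ.* (c ℤ.* (y ℤ.* t))
  regroup = solve-∀

transvection-*M-transvection : ∀ {n} {a b : Fin n} → ¬ a ≡ b → ∀ c d →
  (transvection a b c *M transvection a b d) ≡M transvection a b (c ℤ.+ d)
transvection-*M-transvection {a = a} {b} a≢b c d i j = begin
  (transvection a b c *M transvection a b d) i j
    ≡⟨ transvection-*M a b c (transvection a b d) i j ⟩
  transvection a b d i j ℤ.+ c ℤ.* (identityM a i ℤ.* (identityM b j ℤ.+ d ℤ.* (identityM a b ℤ.* identityM b j)))
    ≡⟨ cong (λ x → transvection a b d i j ℤ.+ c ℤ.* (identityM a i ℤ.* (identityM b j ℤ.+ d ℤ.* (x ℤ.* identityM b j))))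
            (identityM-≢ a≢b) ⟩
  transvection a b d i j ℤ.+ c ℤ.* (identityM a i ℤ.* (identityM b j ℤ.+ d ℤ.* (+ 0 ℤ.* identityM b j)))
    ≡⟨ collect c d (identityM i j) (identityM a i) (identityM b j) ⟩
  transvection a b (c ℤ.+ d) i j ∎
  where
  open ≡-Reasoning
  collect : ∀ c d x y z → x ℤ.+ d ℤ.* (y ℤ.* z) ℤ.+ c ℤ.* (y ℤ.* (z ℤ.+ d ℤ.* (+ 0 ℤ.* z))) ≡ x ℤ.+ (c ℤ.+ d) ℤ.* (y ℤ.* z)
  collect = solve-∀

transvection-zero : ∀ {n} (a b : Fin n) → transvection a b (+ 0) ≡M identityM
transvection-zero a b i j = ℤP.+-identityʳ (identityM i j)

transvection-inGL : ∀ {n} {a b : Fin n} → ¬ a ≡ b → ∀ c → InGL (transvection a b c)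
transvection-inGL {a = a} {b} a≢b c = record
  { inv  = transvection a b (- c)
  ; invˡ = λ i j → trans (transvection-*M-transvection a≢b (- c) c i j)
                         (trans (cong (λ x → transvection a b x i j) (ℤP.+-inverseˡ c)) (transvection-zero a b i j))
  ; invʳ = λ i j → trans (transvection-*M-transvection a≢b c (- c) i j)
                         (trans (cong (λ x → transvection a b x i j) (ℤP.+-inverseʳ c)) (transvection-zero a b i j))
  }

laplacianOf : ∀ {n} → (Fin n → Fin n → ℕ) → Matrix n
laplacianOf A i j with i ≟ j
... | yes _ = + ℕΣ.sum (A i)
... | no  _ = - (+ A i j)

laplacian≡laplacianOf : ∀ {n} (G : DiGraph n) i j → laplacian G i j ≡ laplacianOf (numArrows G) i j
laplacian≡laplacianOf {n} G i j with i ≟ j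
... | yes _ = cong +_ (sumFin≡sum ℕP.+-0-monoid n (numArrows G i))
... | no  _ = refl

laplacianOf-cong : ∀ {n} {A B : Fin n → Fin n → ℕ} → (∀ i j → A i j ≡ B i j) →
                   ∀ i j → laplacianOf A i j ≡ laplacianOf B i j
laplacianOf-cong A≡B i j with i ≟ j
... | yes _ = cong +_ (ℕΣ.sum-cong-≗ (A≡B i))
... | no  _ = cong (-_ ∘ +_) (A≡B i j)

laplacianOf-+ : ∀ {n} (A B : Fin n → Fin n → ℕ) i j →
                laplacianOf (λ i j → A i j + B i j) i j ≡ laplacianOf A i j ℤ.+ laplacianOf B i j
laplacianOf-+ A B i j with i ≟ j
... | yes _ = trans (cong +_ (ℕΣ.∑-distrib-+ (A i) (B i))) (ℤP.pos-+ (ℕΣ.sum (A i)) (ℕΣ.sum (B i)))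
... | no  _ = trans (cong -_ (ℤP.pos-+ (A i j) (B i j))) (ℤP.neg-distrib-+ (+ A i j) (+ B i j))

laplacianOf-diag : ∀ {n} (A : Fin n → Fin n → ℕ) i → laplacianOf A i i ≡ + ℕΣ.sum (A i)
laplacianOf-diag A i with i ≟ i
... | yes _   = refl
... | no  i≢i = contradiction refl i≢i

laplacianOf-off : ∀ {n} (A : Fin n → Fin n → ℕ) {i j} → ¬ i ≡ j → laplacianOf A i j ≡ - (+ A i j)
laplacianOf-off A {i} {j} i≢j with i ≟ j
... | yes i≡j = contradiction i≡j i≢j
... | no  _   = refl

laplacianOf-zero-row : ∀ {n} (A : Fin n → Fin n → ℕ) i → (∀ j → A i j ≡ 0) → ∀ j → laplacianOf A i j ≡ + 0
laplacianOf-zero-row {n} A i row≡0 j with i ≟ j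
... | yes _ = cong +_ (trans (ℕΣ.sum-cong-≗ row≡0) (ℕΣ.sum-replicate-zero n))
... | no  _ = cong (-_ ∘ +_) (row≡0 j)

match-refl : ∀ {n} (a b : Fin n) → match a b a b ≡ 1
match-refl a b with a ≟ a | b ≟ b
... | yes _   | yes _   = refl
... | no  a≢a | _       = contradiction refl a≢a
... | yes _   | no  b≢b = contradiction refl b≢b

match-≢ˡ : ∀ {n} {a b i j : Fin n} → ¬ a ≡ i → match a b i j ≡ 0
match-≢ˡ {a = a} {b} {i} {j} a≢i with a ≟ i | b ≟ j
... | yes a≡i | yes _ = contradiction a≡i a≢i
... | yes _   | no _  = refl
... | no _    | _     = refl

match-≢ʳ : ∀ {n} {a b i j : Fin n} → ¬ b ≡ j → match a b i j ≡ 0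
match-≢ʳ {a = a} {b} {i} {j} b≢j with a ≟ i | b ≟ j
... | yes _ | yes b≡j = contradiction b≡j b≢j
... | yes _ | no _    = refl
... | no _  | _       = refl

match-row : ∀ {n} (a b j : Fin n) → + match a b a j ≡ identityM b j
match-row a b j with a ≟ a | b ≟ j
... | yes _   | yes _ = refl
... | yes _   | no  _ = refl
... | no  a≢a | _     = contradiction refl a≢a

sum-match-row : ∀ {n} (a b : Fin n) → ℕΣ.sum (match a b a) ≡ 1
sum-match-row a b = trans (sum-eq-single ℕP.+-0-monoid (match a b a) b (λ k k≢b → match-≢ʳ (k≢b ∘ sym))) (match-refl a b)

laplacianOf-match : ∀ {n} {a b : Fin n} → ¬ a ≡ b → ∀ i j →
  laplacianOf (match a b) i j ≡ identityM a i ℤ.* (identityM a j ℤ.- identityM b j)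
laplacianOf-match {a = a} {b} a≢b i j = byRow (a ≟ i)
  where
  open ≡-Reasoning
  rhs : ℤ
  rhs = identityM a i ℤ.* (identityM a j ℤ.- identityM b j)
  byRow : Dec (a ≡ i) → laplacianOf (match a b) i j ≡ rhs
  byRow (no a≢i) = begin
    laplacianOf (match a b) i j                         ≡⟨ laplacianOf-zero-row (match a b) i (λ _ → match-≢ˡ a≢i) j ⟩
    + 0 ℤ.* (identityM a j ℤ.- identityM b j)           ≡⟨ cong (ℤ._* _) (identityM-≢ a≢i) ⟨
    rhs                                                 ∎
  byRow (yes refl) = onRow (a ≟ j)
    where
    onRow : Dec (a ≡ j) → laplacianOf (match a b) a j ≡ identityM a a ℤ.* (identityM a j ℤ.- identityM b j)
    onRow (yes refl) = begin
      laplacianOf (match a b) a a                         ≡⟨ trans (laplacianOf-diag (match a b) a) (cong +_ (sum-match-row a b)) ⟩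
      + 1 ℤ.* (+ 1 ℤ.- + 0)                               ≡⟨ cong₂ (λ x y → x ℤ.* (x ℤ.- y)) (identityM-refl a) (identityM-≢ (a≢b ∘ sym)) ⟨
      identityM a a ℤ.* (identityM a a ℤ.- identityM b a) ∎
    onRow (no a≢j) = begin
      laplacianOf (match a b) a j                         ≡⟨ laplacianOf-off (match a b) a≢j ⟩
      - (+ match a b a j)                                 ≡⟨ cong -_ (match-row a b j) ⟩
      - identityM b j                                     ≡⟨ negate-as-product (identityM b j) ⟩
      + 1 ℤ.* (+ 0 ℤ.- identityM b j)                     ≡⟨ cong₂ (λ x y → x ℤ.* (y ℤ.- identityM b j)) (identityM-refl a) (identityM-≢ a≢j) ⟨
      identityM a a ℤ.* (identityM a j ℤ.- identityM b j) ∎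
      where
      negate-as-product : ∀ x → - x ≡ + 1 ℤ.* (+ 0 ℤ.- x)
      negate-as-product = solve-∀

arrowCount-bidirectional : ∀ {n} {v w : Fin n} (e : Arrow n) → bidir e ≡ true →
  (src e ≡ v × tgt e ≡ w) ⊎ (src e ≡ w × tgt e ≡ v) →
  ∀ i j → arrowCount e i j ≡ match v w i j + match w v i j
arrowCount-bidirectional (arrow s t true _) refl (inj₁ (refl , refl)) i j = refl
arrowCount-bidirectional (arrow s t true _) refl (inj₂ (refl , refl)) i j = ℕP.+-comm (match s t i j) _

numArrows-removeAt : ∀ {n} (G : DiGraph n) k i j →
  numArrows G i j ≡ arrowCount (lookup G k) i j + numArrows (removeAt G k) i j
numArrows-removeAt (e ∷ G) zero    i j = refl
numArrows-removeAt (e ∷ G) (suc k) i j =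
  trans (cong (_+_ (arrowCount e i j)) (numArrows-removeAt G k i j)) (x∙yz≈y∙xz (arrowCount e i j) (arrowCount (lookup G k) i j) _)

numArrows-updateAt : ∀ {n} (G : DiGraph n) k (f : Arrow n → Arrow n) i j →
  numArrows (updateAt G k f) i j ≡ arrowCount (f (lookup G k)) i j + numArrows (removeAt G k) i j
numArrows-updateAt (e ∷ G) zero    f i j = refl
numArrows-updateAt (e ∷ G) (suc k) f i j =
  trans (cong (_+_ (arrowCount e i j)) (numArrows-updateAt G k f i j)) (x∙yz≈y∙xz (arrowCount e i j) (arrowCount (f (lookup G k)) i j) _)

module _ {n} (G : DiGraph n) (k : Fin (length G)) {v w : Fin n} (v≢w : ¬ v ≡ w)
         (bidirectional : IsBidirBetween G k v w) where

  private
    G' : DiGraph n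
    G' = replaceOneDir G k v w v≢w

    others : Fin n → Fin n → ℕ
    others = numArrows (removeAt G k)

  numArrows-replaceOneDir : ∀ i j → numArrows G' i j ≡ match v w i j + others i j
  numArrows-replaceOneDir = numArrows-updateAt G k _

  numArrows-bidirectional : ∀ i j → numArrows G i j ≡ match w v i j + numArrows G' i j
  numArrows-bidirectional i j = begin
    numArrows G i j                                ≡⟨ numArrows-removeAt G k i j ⟩
    arrowCount (lookup G k) i j + others i j       ≡⟨ cong (_+ others i j) (arrowCount-bidirectional (lookup G k) (proj₁ bidirectional) (proj₂ bidirectional) i j) ⟩
    (match v w i j + match w v i j) + others i j   ≡⟨ cong (_+ others i j) (ℕP.+-comm (match v w i j) _) ⟩
    (match w v i j + match v w i j) + others i j   ≡⟨ ℕP.+-assoc (match w v i j) _ _ ⟩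
    match w v i j + (match v w i j + others i j)   ≡⟨ cong (_+_ (match w v i j)) (numArrows-replaceOneDir i j) ⟨
    match w v i j + numArrows G' i j               ∎
    where open ≡-Reasoning

  others-row≡0 : outDeg G v ≡ 1 → ∀ j → others v j ≡ 0
  others-row≡0 outDeg≡1 = sum≡0⇒≡0 (others v) (ℕP.suc-injective (begin
    1 + ℕΣ.sum (others v)                      ≡⟨ cong (_+ ℕΣ.sum (others v)) (sum-match-row v w) ⟨
    ℕΣ.sum (match v w v) + ℕΣ.sum (others v)   ≡⟨ ℕΣ.∑-distrib-+ (match v w v) (others v) ⟨
    ℕΣ.sum (λ j → match v w v j + others v j)  ≡⟨ ℕΣ.sum-cong-≗ (numArrows-replaceOneDir v) ⟨
    ℕΣ.sum (numArrows G' v)                    ≡⟨ ℕΣ.sum-cong-≗ no-arrow-w→v ⟨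
    ℕΣ.sum (numArrows G v)                     ≡⟨ sumFin≡sum ℕP.+-0-monoid n (numArrows G v) ⟨
    outDeg G v                                 ≡⟨ outDeg≡1 ⟩
    1                                          ∎))
    where
    open ≡-Reasoning
    no-arrow-w→v : ∀ j → numArrows G v j ≡ numArrows G' v j
    no-arrow-w→v j = trans (numArrows-bidirectional v j) (cong (_+ numArrows G' v j) (match-≢ˡ (v≢w ∘ sym)))

  laplacian-bidirectional : ∀ i j → laplacian G i j ≡ laplacianOf (match w v) i j ℤ.+ laplacian G' i j
  laplacian-bidirectional i j = begin
    laplacian G i j                                                 ≡⟨ laplacian≡laplacianOf G i j ⟩
    laplacianOf (numArrows G) i j                                   ≡⟨ laplacianOf-cong numArrows-bidirectional i j ⟩
    laplacianOf (λ i j → match w v i j + numArrows G' i j) i j      ≡⟨ laplacianOf-+ (match w v) (numArrows G') i j ⟩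
    laplacianOf (match w v) i j ℤ.+ laplacianOf (numArrows G') i j  ≡⟨ cong (ℤ._+_ (laplacianOf (match w v) i j)) (laplacian≡laplacianOf G' i j) ⟨
    laplacianOf (match w v) i j ℤ.+ laplacian G' i j                ∎
    where open ≡-Reasoning

  laplacian-replaceOneDir-split : ∀ i j → laplacian G' i j ≡ laplacianOf (match v w) i j ℤ.+ laplacianOf others i j
  laplacian-replaceOneDir-split i j = begin
    laplacian G' i j                                          ≡⟨ laplacian≡laplacianOf G' i j ⟩
    laplacianOf (numArrows G') i j                            ≡⟨ laplacianOf-cong numArrows-replaceOneDir i j ⟩
    laplacianOf (λ i j → match v w i j + others i j) i j      ≡⟨ laplacianOf-+ (match v w) others i j ⟩
    laplacianOf (match v w) i j ℤ.+ laplacianOf others i j    ∎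
    where open ≡-Reasoning

  laplacian-row : outDeg G v ≡ 1 → ∀ j → laplacian G v j ≡ identityM v j ℤ.- identityM w j
  laplacian-row outDeg≡1 j = begin
    laplacian G v j
      ≡⟨ laplacian-bidirectional v j ⟩
    laplacianOf (match w v) v j ℤ.+ laplacian G' v j
      ≡⟨ cong₂ ℤ._+_ (laplacianOf-zero-row (match w v) v (λ _ → match-≢ˡ (v≢w ∘ sym)) j) (laplacian-replaceOneDir-split v j) ⟩
    + 0 ℤ.+ (laplacianOf (match v w) v j ℤ.+ laplacianOf others v j)
      ≡⟨ cong₂ (λ x y → + 0 ℤ.+ (x ℤ.+ y)) (laplacianOf-match v≢w v j) (laplacianOf-zero-row others v (others-row≡0 outDeg≡1) j) ⟩
    + 0 ℤ.+ (identityM v v ℤ.* (identityM v j ℤ.- identityM w j) ℤ.+ + 0)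
      ≡⟨ cong (λ x → + 0 ℤ.+ (x ℤ.* (identityM v j ℤ.- identityM w j) ℤ.+ + 0)) (identityM-refl v) ⟩
    + 0 ℤ.+ (+ 1 ℤ.* (identityM v j ℤ.- identityM w j) ℤ.+ + 0)
      ≡⟨ simplify (identityM v j ℤ.- identityM w j) ⟩
    identityM v j ℤ.- identityM w j
      ∎
    where
    open ≡-Reasoning
    simplify : ∀ x → + 0 ℤ.+ (+ 1 ℤ.* x ℤ.+ + 0) ≡ x
    simplify = solve-∀

  laplacian-replaceOneDir : outDeg G v ≡ 1 → ∀ i j →
    laplacian G' i j ≡ laplacian G i j ℤ.+ + 1 ℤ.* (identityM w i ℤ.* laplacian G v j)
  laplacian-replaceOneDir outDeg≡1 i j = begin
    laplacian G' i j
      ≡⟨ cancel (identityM w i) (identityM w j) (identityM v j) (laplacian G' i j) ⟩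
    (identityM w i ℤ.* (identityM w j ℤ.- identityM v j) ℤ.+ laplacian G' i j) ℤ.+ + 1 ℤ.* (identityM w i ℤ.* (identityM v j ℤ.- identityM w j))
      ≡⟨ cong₂ (λ x y → (x ℤ.+ laplacian G' i j) ℤ.+ + 1 ℤ.* (identityM w i ℤ.* y)) (laplacianOf-match (v≢w ∘ sym) i j) (laplacian-row outDeg≡1 j) ⟨
    (laplacianOf (match w v) i j ℤ.+ laplacian G' i j) ℤ.+ + 1 ℤ.* (identityM w i ℤ.* laplacian G v j)
      ≡⟨ cong (ℤ._+ + 1 ℤ.* (identityM w i ℤ.* laplacian G v j)) (laplacian-bidirectional i j) ⟨
    laplacian G i j ℤ.+ + 1 ℤ.* (identityM w i ℤ.* laplacian G v j)
      ∎
    where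
    open ≡-Reasoning
    cancel : ∀ x y z t → t ≡ (x ℤ.* (y ℤ.- z) ℤ.+ t) ℤ.+ + 1 ℤ.* (x ℤ.* (z ℤ.- y))
    cancel = solve-∀

lemma4p17 : {n : ℕ} (G : DiGraph n) (k : Fin (length G)) (v w : Fin n)
    → (v≢w : ¬ (v ≡ w))
    → IsBidirBetween G k v w
    → outDeg G v ≡ 1
    → RowEquiv (laplacian G) (laplacian (replaceOneDir G k v w v≢w))
lemma4p17 G k v w v≢w bidirectional outDeg≡1 =
  transvection w v (+ 1) , transvection-inGL (v≢w ∘ sym) (+ 1) , λ i j →
    trans (laplacian-replaceOneDir G k v≢w bidirectional outDeg≡1 i j)
          (sym (transvection-*M w v (+ 1) (laplacian G) i j))
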